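{- Let $\Phi$ be a finite closed set of $\Lambda(\mathcal L)$-formulas, let $\mathbb S=\langle S,\sigma,V\rangle$ be a $T$-model and let $\underline{\mathbb S}=\langle\underline S,\underline\sigma,\underline V\rangle$ be a $\Phi$-filtration of $\mathbb S$. Then $\|\varphi\|_\sigma(s)=\|\varphi\|_{\underline\sigma}(\underline s)$ for every $\varphi\in\Phi$ and every $s\in S$.
   Context: $\mathbb A$ with domain $A$ is one of: (i) a finite Łukasiewicz chain Ł$_n$ with language $\mathcal L$: $\varphi::=p\mid\bar1\mid\bar0\mid\varphi\vee\varphi\mid\varphi\wedge\varphi\mid\varphi\odot\varphi\mid\varphi\to\varphi$; (ii) a finite FL$_{ew}$-algebra (commutative integral bounded residuated lattice) with Baaz Delta $\Delta(x)=1$ iff $x=1$ (else $0$), language adding $\Delta$ and constants $\bar c$ for all $c\in A$; (iii) a finite FL$_{ew}$-algebra with $\tau_c(x)=1$ iff $x=c$, $\upsilon_c(x)=1$ iff $x\ge c$ (else $0$), language adding unary $\tau_c,\upsilon_c$. $p$ ranges over a set $\mathsf P$ of atoms. $T:\mathsf{Set}\to\mathsf{Set}$ is a functor; an $n$-ary predicate lifting is a natural transformation $\lambda:Hom(-,A^n)\Rightarrow Hom(T(-),A)$ of contravariant functors on $\mathsf{Set}$ (acting on maps by precomposition); $\Lambda$ is a set of them; $\Lambda(\mathcal L)$ extends $\mathcal L$ with $\heartsuit_\lambda(\varphi_0,\dots,\varphi_{n-1})$ for $n$-ary $\lambda\in\Lambda$. A $T$-model is $\langle S,\sigma,V\rangle$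 with $S\ne\emptyset$, $\sigma:S\to TS$, $V:\mathsf P\to Hom(S,A)$; $\|p\|_\sigma=V(p)$, $\|\bar c\|_\sigma\equiv c$, connectives pointwise, $\|\heartsuit_\lambda(\varphi_0,\dots)\|_\sigma(s)=\lambda_S(\langle\|\varphi_0\|_\sigma,\dots\rangle)(\sigma(s))$. A set $\Phi$ of formulas is closed if it is closed under subformulas and contains $\top=\bar1$, $\bot=\bar0$ (and $\bar c$ for every $c\in A$ in case (ii)). Given $\Phi$ and $\mathbb S$, $s\equiv_\Phi t$ iff $\|\varphi\|_\sigma(s)=\|\varphi\|_\sigma(t)$ for all $\varphi\in\Phi$; $\underline s$ is the class of $s$, $\underline S$ the quotient set, $q:S\to\underline S$ the quotient map, and a representative choice function is any $r:\underline S\to S$ with $r(\underline s)\in\underline s$. A $\Phi$-filtration of $\mathbb S$ is any $T$-model $\langle\underline S,\underline\sigma,\underline V\rangle$ with $\underline\sigma=Tq\circ\sigma\circ r$ for some representative choice function $r$, and $\underline V(p)(\underline s)=V(p)(s)$ for every atom $p\in\Phi$ and $s\in S$. -}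

module Defs where

open import Data.Nat using (ℕ; zero; suc; _+_; _∸_; _⊔_; _⊓_)
open import Data.Fin using (Fin; zero; suc; toℕ; fromℕ)
open import Data.Bool using (Bool; true; false; if_then_else_)
open import Data.Empty using (⊥)
open import Data.Unit using (⊤)
open import Data.Product using (Σ; ∃; _×_; _,_)
open import Data.List using (List)
open import Data.List.Membership.Propositional using (_∈_)
open import Function using (_∘_; id; _↔_)
open import Relation.Nullary using (does)
open import Relation.Binary.Definitions using (DecidableEquality)
open import Relation.Binary.PropositionalEquality using (_≡_)
open import Relation.Binary.Construct.Closure.ReflexiveTransitive using (Star)

record Functor : Set₁ where
  field
    F         : Set → Set
    fmap      : ∀ {X Y : Set} → (X → Y) → F X → F Y
    fmap-cong : ∀ {X Y : Set} {f g : X → Y} → (∀ x → f x ≡ g x) →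
                ∀ t → fmap f t ≡ fmap g t
    fmap-id   : ∀ {X : Set} (t : F X) → fmap id t ≡ t
    fmap-∘    : ∀ {X Y Z : Set} (f : X → Y) (g : Y → Z) (t : F X) →
                fmap (g ∘ f) t ≡ fmap g (fmap f t)

-- n-ary predicate liftings  λ : Hom(-, Aⁿ) ⇒ Hom(T -, A)
-- (Aⁿ represented as Fin n → A; hom-sets carry pointwise equality,
--  components respect it; naturality: λ_X (f ∘ h) = λ_Y f ∘ T h)

record PredLifting (T : Functor) (A : Set) (n : ℕ) : Set₁ where
  open Functor T
  field
    lift      : ∀ {X : Set} → (X → Fin n → A) → F X → A
    lift-cong : ∀ {X : Set} {f g : X → Fin n → A} →
                (∀ x i → f x i ≡ g x i) → ∀ t → lift f t ≡ lift g t
    natural   : ∀ {X Y : Set} (h : X → Y) (f : Y → Fin n → A) (t : F X) →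
                lift (f ∘ h) t ≡ lift f (fmap h t)

record Liftings (T : Functor) (A : Set) : Set₁ where
  field
    Idx   : Set
    arity : Idx → ℕ
    lam   : (i : Idx) → PredLifting T A (arity i)

record FLew : Set₁ where
  infixr 6 _∨_
  infixr 7 _∧_
  infixr 7 _⊙_
  infixr 5 _⇒_
  field
    Carrier : Set
    _≟_     : DecidableEquality Carrier
    finite  : Σ ℕ (λ n → Carrier ↔ Fin n)
    _∨_ _∧_ _⊙_ _⇒_ : Carrier → Carrier → Carrier
    0a 1a   : Carrier
    ∨-assoc : ∀ x y z → (x ∨ y) ∨ z ≡ x ∨ (y ∨ z)
    ∨-comm  : ∀ x y → x ∨ y ≡ y ∨ x
    ∧-assoc : ∀ x y z → (x ∧ y) ∧ z ≡ x ∧ (y ∧ z)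
    ∧-comm  : ∀ x y → x ∧ y ≡ y ∧ x
    ∨-absorbs-∧ : ∀ x y → x ∨ (x ∧ y) ≡ x
    ∧-absorbs-∨ : ∀ x y → x ∧ (x ∨ y) ≡ x
    0-bottom : ∀ x → 0a ∧ x ≡ 0a
    1-top    : ∀ x → x ∧ 1a ≡ x
    ⊙-assoc : ∀ x y z → (x ⊙ y) ⊙ z ≡ x ⊙ (y ⊙ z)
    ⊙-comm  : ∀ x y → x ⊙ y ≡ y ⊙ x
    ⊙-unit  : ∀ x → x ⊙ 1a ≡ x
    -- residuation, with x ≤ y  :⇔  x ∧ y ≡ x
    residuation₁ : ∀ x y z → (x ⊙ y) ∧ z ≡ x ⊙ y → x ∧ (y ⇒ z) ≡ x
    residuation₂ : ∀ x y z → x ∧ (y ⇒ z) ≡ x → (x ⊙ y) ∧ z ≡ x ⊙ y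

record Sig : Set₁ where
  field
    Carrier : Set
    top bot : Carrier
    join meet fus imp : Carrier → Carrier → Carrier
    Con  : Set
    conI : Con → Carrier
    Un   : Set
    unI  : Un → Carrier → Carrier

-- Case (i): Łukasiewicz chain Ł_N, N = suc m ≥ 1, elements k/N (k = 0..N)
toFin : (N x : ℕ) → Fin (suc N)
toFin zero    x       = zero
toFin (suc N) zero    = zero
toFin (suc N) (suc x) = suc (toFin N x)

ŁukSig : ℕ → Sig
ŁukSig m = record
  { Carrier = Fin (suc N)
  ; top  = fromℕ N
  ; bot  = zero
  ; join = λ a b → toFin N (toℕ a ⊔ toℕ b)
  ; meet = λ a b → toFin N (toℕ a ⊓ toℕ b)
  ; fus  = λ a b → toFin N ((toℕ a + toℕ b) ∸ N)     -- max(0, a+b-1)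
  ; imp  = λ a b → toFin N ((N ∸ toℕ a) + toℕ b)     -- min(1, 1-a+b)
  ; Con  = ⊥ ; conI = λ ()
  ; Un   = ⊥ ; unI  = λ ()
  }
  where N = suc m

DeltaSig : FLew → Sig
DeltaSig 𝔸 = record
  { Carrier = Carrier ; top = 1a ; bot = 0a
  ; join = _∨_ ; meet = _∧_ ; fus = _⊙_ ; imp = _⇒_
  ; Con = Carrier ; conI = λ c → c
  ; Un = ⊤ ; unI = λ _ x → if does (x ≟ 1a) then 1a else 0a
  }
  where open FLew 𝔸

data TU (A : Set) : Set where
  τ : A → TU A
  υ : A → TU A

TauSig : FLew → Sig
TauSig 𝔸 = record
  { Carrier = Carrier ; top = 1a ; bot = 0a
  ; join = _∨_ ; meet = _∧_ ; fus = _⊙_ ; imp = _⇒_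
  ; Con = ⊥ ; conI = λ ()
  ; Un = TU Carrier ; unI = op
  }
  where
  open FLew 𝔸
  op : TU Carrier → Carrier → Carrier
  op (τ c) x = if does (x ≟ c) then 1a else 0a
  op (υ c) x = if does ((c ∧ x) ≟ c) then 1a else 0a   -- x ≥ c

data AlgCase : Set₁ where
  łuk   : ℕ → AlgCase          -- Ł_(suc m)
  delta : FLew → AlgCase
  tauUp : FLew → AlgCase

sigOf : AlgCase → Sig
sigOf (łuk m)   = ŁukSig m
sigOf (delta 𝔸) = DeltaSig 𝔸
sigOf (tauUp 𝔸) = TauSig 𝔸

data Fm (Con Un P Idx : Set) (ar : Idx → ℕ) : Set where
  var  : P → Fm Con Un P Idx ar
  ⊤̄ ⊥̄  : Fm Con Un P Idx ar
  _∨̇_ _∧̇_ _⊙̇_ _⇒̇_ : Fm Con Un P Idx ar → Fm Con Un P Idx ar → Fm Con Un P Idx ar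
  const : Con → Fm Con Un P Idx ar
  un    : Un → Fm Con Un P Idx ar → Fm Con Un P Idx ar
  ♡     : (i : Idx) → (Fin (ar i) → Fm Con Un P Idx ar) → Fm Con Un P Idx ar

module Language (𝒞 : AlgCase) (T : Functor)
                (Λ : Liftings T (Sig.Carrier (sigOf 𝒞))) (P : Set) where

  open Sig (sigOf 𝒞)
  open Functor T
  open Liftings Λ

  Form : Set
  Form = Fm Con Un P Idx arity

  data _◃_ : Form → Form → Set where
    ∨l : ∀ {φ ψ} → φ ◃ (φ ∨̇ ψ)
    ∨r : ∀ {φ ψ} → ψ ◃ (φ ∨̇ ψ)
    ∧l : ∀ {φ ψ} → φ ◃ (φ ∧̇ ψ)
    ∧r : ∀ {φ ψ} → ψ ◃ (φ ∧̇ ψ)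
    ⊙l : ∀ {φ ψ} → φ ◃ (φ ⊙̇ ψ)
    ⊙r : ∀ {φ ψ} → ψ ◃ (φ ⊙̇ ψ)
    ⇒l : ∀ {φ ψ} → φ ◃ (φ ⇒̇ ψ)
    ⇒r : ∀ {φ ψ} → ψ ◃ (φ ⇒̇ ψ)
    un◃ : ∀ {u φ} → φ ◃ un u φ
    ♡◃ : ∀ {i φs} (k : Fin (arity i)) → φs k ◃ ♡ i φs

  _≼_ : Form → Form → Set
  _≼_ = Star _◃_

  record Closed (Φ : List Form) : Set where
    field
      sub-closed : ∀ {φ ψ} → ψ ≼ φ → φ ∈ Φ → ψ ∈ Φ
      has-⊤      : ⊤̄ ∈ Φ
      has-⊥      : ⊥̄ ∈ Φ
      has-const  : ∀ (c : Con) → const c ∈ Φ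

  record Model : Set₁ where
    field
      S     : Set
      s₀    : S                 -- S ≠ ∅
      σ     : S → F S
      V     : P → S → Carrier

  ⟦_⟧ : Form → (M : Model) → Model.S M → Carrier
  ⟦ var p ⟧ M s   = Model.V M p s
  ⟦ ⊤̄ ⟧ M s       = top
  ⟦ ⊥̄ ⟧ M s       = bot
  ⟦ φ ∨̇ ψ ⟧ M s   = join (⟦ φ ⟧ M s) (⟦ ψ ⟧ M s)
  ⟦ φ ∧̇ ψ ⟧ M s   = meet (⟦ φ ⟧ M s) (⟦ ψ ⟧ M s)
  ⟦ φ ⊙̇ ψ ⟧ M s   = fus (⟦ φ ⟧ M s) (⟦ ψ ⟧ M s)
  ⟦ φ ⇒̇ ψ ⟧ M s   = imp (⟦ φ ⟧ M s) (⟦ ψ ⟧ M s)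
  ⟦ const c ⟧ M s = conI c
  ⟦ un u φ ⟧ M s  = unI u (⟦ φ ⟧ M s)
  ⟦ ♡ i φs ⟧ M s  =
    PredLifting.lift (lam i) (λ t k → ⟦ φs k ⟧ M t) (Model.σ M s)

  -- The quotient S/≡_Φ, given (up to bijection) by its universal description:
  -- a set Q with a surjection q whose kernel is exactly ≡_Φ.
  record Quotient (M : Model) (Φ : List Form) : Set₁ where
    open Model M
    field
      Q         : Set
      q         : S → Q
      q-surj    : ∀ x → ∃ λ s → q s ≡ x
      q-kernel₁ : ∀ s t → q s ≡ q t → ∀ φ → φ ∈ Φ → ⟦ φ ⟧ M s ≡ ⟦ φ ⟧ M t
      q-kernel₂ : ∀ s t → (∀ φ → φ ∈ Φ → ⟦ φ ⟧ M s ≡ ⟦ φ ⟧ M t) → q s ≡ q t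

  record Filtration (M : Model) (Φ : List Form) (𝒬 : Quotient M Φ) : Set₁ where
    open Model M
    open Quotient 𝒬
    field
      r     : Q → S
      r-rep : ∀ x → q (r x) ≡ x
      σ̲     : Q → F Q
      V̲     : P → Q → Carrier
      σ-def : ∀ x → σ̲ x ≡ fmap q (σ (r x))
      V-def : ∀ p → var p ∈ Φ → ∀ s → V̲ p (q s) ≡ V p s

    model : Model
    model = record { S = Q ; s₀ = q s₀ ; σ = σ̲ ; V = V̲ }

-- For ♡λ(φ⃗) at s, pass to the
-- representative r(q s): it is Φ-equivalent to s, so ♡λ(φ⃗) has the same value there. By the
-- induction hypothesis the argument valuations factor through q, and naturality of λ moves q
-- into T q, which is exactly how σ̲(q s) = T q (σ (r (q s))) is built.
module Submission where

open import Defs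
open import Data.List using (List)
open import Data.List.Membership.Propositional using (_∈_)
open import Data.Nat using (ℕ)
open import Data.Fin using (Fin)
open import Function using (_∘_)
open import Relation.Binary.PropositionalEquality
  using (_≡_; refl; sym; cong; cong₂; module ≡-Reasoning)
open import Relation.Binary.Construct.Closure.ReflexiveTransitive using (ε; _◅_)

lift-fmap : {T : Functor} {A : Set} {n : ℕ} (λ′ : PredLifting T A n) {X Y : Set}
            (h : X → Y) (f : X → Fin n → A) (g : Y → Fin n → A) →
            (∀ x k → f x k ≡ g (h x) k) →
            ∀ t → PredLifting.lift λ′ f t ≡ PredLifting.lift λ′ g (Functor.fmap T h t)
lift-fmap {T} λ′ h f g f≗g∘h t = begin
  lift f t             ≡⟨ lift-cong f≗g∘h t ⟩
  lift (g ∘ h) t       ≡⟨ natural h g t ⟩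
  lift g (fmap h t)    ∎
  where
  open ≡-Reasoning
  open PredLifting λ′
  open Functor T

module Filtrations (𝒞 : AlgCase) (T : Functor) (Λ : Liftings T (Sig.Carrier (sigOf 𝒞))) (P : Set) where
  open Language 𝒞 T Λ P
  open Sig (sigOf 𝒞)
  open Functor T
  open Liftings Λ

  ∈-◃ : ∀ {Φ} → Closed Φ → ∀ {φ ψ} → ψ ◃ φ → φ ∈ Φ → ψ ∈ Φ
  ∈-◃ cl ψ◃φ = Closed.sub-closed cl (ψ◃φ ◅ ε)

  module _ {Φ : List Form} {M : Model} {𝒬 : Quotient M Φ} (𝔽 : Filtration M Φ 𝒬) where
    open Model M
    open Quotient 𝒬
    open Filtration 𝔽

    ⟦⟧-representative : ∀ φ → φ ∈ Φ → ∀ s → ⟦ φ ⟧ M s ≡ ⟦ φ ⟧ M (r (q s))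
    ⟦⟧-representative φ φ∈Φ s = q-kernel₁ s (r (q s)) (sym (r-rep (q s))) φ φ∈Φ

    filtration-lemma : Closed Φ → ∀ φ → φ ∈ Φ → ∀ s → ⟦ φ ⟧ M s ≡ ⟦ φ ⟧ model (q s)
    filtration-lemma cl = go
      where
      go : ∀ φ → φ ∈ Φ → ∀ s → ⟦ φ ⟧ M s ≡ ⟦ φ ⟧ model (q s)
      go (var p)   φ∈Φ s = sym (V-def p φ∈Φ s)
      go ⊤̄         φ∈Φ s = refl
      go ⊥̄         φ∈Φ s = refl
      go (φ ∨̇ ψ)   φ∈Φ s = cong₂ join (go φ (∈-◃ cl ∨l φ∈Φ) s) (go ψ (∈-◃ cl ∨r φ∈Φ) s)
      go (φ ∧̇ ψ)   φ∈Φ s = cong₂ meet (go φ (∈-◃ cl ∧l φ∈Φ) s) (go ψ (∈-◃ cl ∧r φ∈Φ) s)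
      go (φ ⊙̇ ψ)   φ∈Φ s = cong₂ fus  (go φ (∈-◃ cl ⊙l φ∈Φ) s) (go ψ (∈-◃ cl ⊙r φ∈Φ) s)
      go (φ ⇒̇ ψ)   φ∈Φ s = cong₂ imp  (go φ (∈-◃ cl ⇒l φ∈Φ) s) (go ψ (∈-◃ cl ⇒r φ∈Φ) s)
      go (const c) φ∈Φ s = refl
      go (un u φ)  φ∈Φ s = cong (unI u) (go φ (∈-◃ cl un◃ φ∈Φ) s)
      go (♡ i φs)  φ∈Φ s = begin
        ⟦ ♡ i φs ⟧ M s                              ≡⟨ ⟦⟧-representative (♡ i φs) φ∈Φ s ⟩
        lift (λ t k → ⟦ φs k ⟧ M t) (σ (r (q s)))     ≡⟨ lift-fmap (lam i) q _ _ ih (σ (r (q s))) ⟩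
        lift (λ x k → ⟦ φs k ⟧ model x) (fmap q (σ (r (q s))))
                                                    ≡⟨ cong (lift (λ x k → ⟦ φs k ⟧ model x)) (sym (σ-def (q s))) ⟩
        ⟦ ♡ i φs ⟧ model (q s)                      ∎
        where
        open ≡-Reasoning
        open PredLifting (lam i)
        ih : ∀ t k → ⟦ φs k ⟧ M t ≡ ⟦ φs k ⟧ model (q t)
        ih t k = go (φs k) (∈-◃ cl (♡◃ k) φ∈Φ) t

mainTheorem3 : (𝒞 : AlgCase) (T : Functor) (Λ : Liftings T (Sig.Carrier (sigOf 𝒞))) (P : Set)
    → let open Language 𝒞 T Λ P in
      (Φ : List Form) → Closed Φ
    → (M : Model) (𝒬 : Quotient M Φ) (𝔽 : Filtration M Φ 𝒬)
    → ∀ φ → φ ∈ Φ → ∀ (s : Model.S M)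
    → ⟦ φ ⟧ M s ≡ ⟦ φ ⟧ (Filtration.model 𝔽) (Quotient.q 𝒬 s)
mainTheorem3 𝒞 T Λ P Φ cl M 𝒬 𝔽 = Filtrations.filtration-lemma 𝒞 T Λ P 𝔽 cl
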